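{- Let $\delta$ be a congruence of $\mathbf{L}_n$ with frequency $\mathsf{f}_\delta=2$, and let $\theta=\langle k;\bar r\rangle$ be a congruence of $\mathbf{L}_n$. (1) If $\theta$ is mirrored, then $\theta\circ\delta=\delta\circ\theta$. (2) If $\theta$ is not mirrored, then $\theta\vee\delta=\{0,\dots,n\}^2$.
   Context: For an integer $n\ge 0$, the line $\mathbf{L}_n$ is the frame $\langle\{0,\dots,n\},R\rangle$ where $x\mathrel{R}y$ iff $|x-y|\le 1$. A congruence of $\mathbf{L}_n$ is an equivalence relation $\theta$ on $\{0,\dots,n\}$ such that whenever $x'\mathrel{\theta}x$ and $x\mathrel{R}y$ there is $y'$ with $x'\mathrel{R}y'$ and $y'\mathrel{\theta}y$; the join of congruences is the equivalence relation generated by their union. For $k\ge1$ and a strictly increasing sequence $\bar r$ of non-negative integers, $\Delta_{\bar r}(x)=|\{i: r_i<x\}|$ and $x\,\langle k;\bar r\rangle\,y$ iff $x-\Delta_{\bar r}(x)\equiv \pm(y-\Delta_{\bar r}(y))\pmod{2k}$. Every congruence with more than one class equals $\langle k;\bar r\rangle$ where $k$ is the number of classes minus one (the step) and $\bar r$ lists the $r$ with $r\mathrel{\theta}r+1$; its frequency is $(n-|\bar r|)/k$. Congruences of frequency $2$ are exactly those with $a\mathrel{\delta}b$ iff $a=b$ or $a+b=n$. The congruence $\langle k;\bar r\rangle$ is mirrored if for every $r$: $r$ is an entry of $\bar r$ iff $n-r-1$ is an entry of $\bar r$. -}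

module Defs where

open import Level using (0ℓ)
open import Data.Nat using (ℕ; zero; suc; _+_; _*_; _∸_; _≤_; _<_; _<ᵇ_)
open import Data.Nat.Properties using ()
open import Data.Bool using (if_then_else_)
open import Data.Integer as ℤ using (ℤ; +_)
open import Data.Integer.Divisibility using () renaming (_∣_ to _∣ℤ_)
open import Data.Fin using (Fin)
open import Data.List using (List; []; _∷_; length)
open import Data.List.Membership.Propositional using (_∈_)
open import Data.List.Relation.Unary.All using (All)
open import Data.List.Relation.Unary.Linked using (Linked)
open import Data.Product using (Σ; ∃; _×_; _,_)
open import Data.Sum using (_⊎_)
open import Function.Bundles using (_⇔_)
open import Relation.Binary.Core using (Rel)
open import Relation.Binary.PropositionalEquality using (_≡_)

-- Binary relations on ℕ; only their restriction to {0,…,n} matters.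
Relation : Set₁
Relation = Rel ℕ 0ℓ

-- The accessibility relation of the line L_n : x R y iff |x - y| ≤ 1.
Adj : ℕ → ℕ → Set
Adj x y = (x ≤ suc y) × (y ≤ suc x)

record IsCongruence (n : ℕ) (θ : Relation) : Set where
  field
    dom   : ∀ {x y} → θ x y → (x ≤ n) × (y ≤ n)
    refl  : ∀ {x} → x ≤ n → θ x x
    sym   : ∀ {x y} → θ x y → θ y x
    trans : ∀ {x y z} → θ x y → θ y z → θ x z
    zig   : ∀ {x x' y} → y ≤ n → θ x' x → Adj x y →
            Σ ℕ λ y' → (y' ≤ n) × Adj x' y' × θ y' y

Δ : List ℕ → ℕ → ℕ
Δ [] x = 0
Δ (r ∷ rs) x = (if r <ᵇ x then 1 else 0) + Δ rs x

CongKR : ℕ → ℕ → List ℕ → Relation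
CongKR n k rs x y =
  (x ≤ n) × (y ≤ n) ×
  (((+ (2 * k)) ∣ℤ ((+ (x ∸ Δ rs x)) ℤ.- (+ (y ∸ Δ rs y))))
   ⊎ ((+ (2 * k)) ∣ℤ ((+ (x ∸ Δ rs x)) ℤ.+ (+ (y ∸ Δ rs y)))))

SameOn : ℕ → Relation → Relation → Set
SameOn n θ δ = ∀ x y → x ≤ n → y ≤ n → (θ x y ⇔ δ x y)

Comp : ℕ → Relation → Relation → Relation
Comp n θ δ x y = Σ ℕ λ z → (z ≤ n) × θ x z × δ z y

data Join (n : ℕ) (θ δ : Relation) : Relation where
  inl   : ∀ {x y} → x ≤ n → y ≤ n → θ x y → Join n θ δ x y
  inr   : ∀ {x y} → x ≤ n → y ≤ n → δ x y → Join n θ δ x y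
  refl  : ∀ {x} → x ≤ n → Join n θ δ x x
  sym   : ∀ {x y} → Join n θ δ x y → Join n θ δ y x
  trans : ∀ {x y z} → Join n θ δ x y → Join n θ δ y z → Join n θ δ x z

IsTotal : ℕ → Relation → Set
IsTotal n θ = ∀ x y → x ≤ n → y ≤ n → θ x y

NumClasses : ℕ → Relation → ℕ → Set
NumClasses n θ m =
  Σ (Fin m → ℕ) λ rep →
    (∀ i → rep i ≤ n) ×
    (∀ i j → θ (rep i) (rep j) → i ≡ j) ×
    (∀ x → x ≤ n → ∃ λ i → θ x (rep i))

StrictlyIncreasing : List ℕ → Set
StrictlyIncreasing = Linked _<_

-- θ (a congruence with more than one class) has frequency f:
-- θ = ⟨k;r̄⟩ where k = (number of classes) - 1, r̄ lists (increasingly)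
-- the r with r θ r+1, and (n - |r̄|)/k = f, i.e. n - |r̄| = f·k.
HasFrequency : ℕ → Relation → ℕ → Set
HasFrequency n θ f =
  Σ ℕ λ k → Σ (List ℕ) λ rs →
    (1 ≤ k) ×
    NumClasses n θ (suc k) ×
    StrictlyIncreasing rs ×
    All (_< n) rs ×
    (∀ r → r < n → (r ∈ rs ⇔ θ r (suc r))) ×
    SameOn n θ (CongKR n k rs) ×
    (n ∸ length rs ≡ f * k)

Mirrored : ℕ → List ℕ → Set
Mirrored n rs = ∀ r → r < n → (r ∈ rs ⇔ (n ∸ r ∸ 1) ∈ rs)

-- Everything is read off the collapsed coordinate t x = x - Δ(x): ⟨k;r̄⟩
-- relates x and y iff t x ≡ ±t y (mod 2k), and t rises by 0 ("stutters") at
-- the entries of r̄ and by 1 elsewhere.  The back-and-forth condition makes t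
-- rigid: once t reaches k, it is the identity on 0,…,k, it does not stutter
-- in the last k steps, and stutter points and n sit at multiples of k.
-- For δ (where t n = 2k) this yields t x + t (n - x) = 2k, so δ relates x
-- exactly to x and n - x.  (1) If r̄ is mirrored then t (n - x) = t n - t x,
-- θ is invariant under x ↦ n - x, and θ, δ commute.  (2) Otherwise, at the
-- first asymmetric pair of edges, δ and a stutter join some q to q + 1 where
-- t q or t (q + 1) is a multiple of k; then the join links 0 with 1 or k
-- with k - 1, and since joins keep the back-and-forth property it spreads
-- from there to all of {0,…,n}.
module Submission where

open import Defs renaming (refl to join-refl; sym to join-sym; trans to join-trans)
open import Data.Nat
  using (ℕ; zero; suc; pred; _+_; _*_; _∸_; _≤_; _<_; _≤?_; _≤′_; ≤′-refl; ≤′-step; z≤n; s≤s; NonZero; ∣_-_∣; _<ᵇ_)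
import Data.Nat.Properties as ℕ
open import Data.Nat.Divisibility
  using (_∣_; divides; n∣m*n; ∣m∣n⇒∣m+n; ∣m+n∣m⇒∣n; ∣-refl; ∣⇒≤; _∣0; %-presˡ-∣; *-monoʳ-∣)
open import Data.Nat.DivMod using (_%_; _/_; m≡m%n+[m/n]*n; m%n<n)
open import Data.Nat.Tactic.RingSolver using () renaming (solve-∀ to ℕ-solve)
open import Data.Integer as ℤ using (+_)
import Data.Integer.Properties as ℤ
open import Data.Integer.Divisibility using () renaming (_∣_ to _∣ᵘ_)
import Data.Integer.Divisibility.Signed as Signed
open import Data.Integer.Tactic.RingSolver using () renaming (solve-∀ to ℤ-solve)
open import Data.Bool using (true; false; if_then_else_)
open import Data.Bool.Properties using (T-≡)
open import Data.List using (List; []; _∷_; length)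
open import Data.List.Relation.Unary.All using (All; []; _∷_)
import Data.List.Relation.Unary.All as All
open import Data.List.Relation.Unary.AllPairs using (AllPairs; []; _∷_)
open import Data.List.Relation.Unary.Any using (here; there)
open import Data.List.Relation.Unary.Linked.Properties using (Linked⇒AllPairs)
open import Data.List.Membership.Propositional using (_∈_; _∉_)
open import Data.List.Membership.DecPropositional ℕ._≟_ using (_∈?_)
open import Function using (_∘_)
open import Function.Bundles using (Equivalence; _⇔_; mk⇔)
open import Data.Product using (_×_; _,_; Σ; ∃; proj₁; proj₂)
open import Data.Sum using (_⊎_; inj₁; inj₂)
open import Data.Empty using (⊥; ⊥-elim)
open import Data.Fin as Fin using (Fin)
import Data.Fin.Properties as Fin
open import Relation.Nullary using (¬_; yes; no)
open import Relation.Binary.Definitions using (tri<; tri≈; tri>)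
open import Relation.Binary.PropositionalEquality using (_≡_; _≢_; refl; sym; trans; cong; cong₂; subst; subst₂)

infix 4 _≡±_[_]

-- a ≡± b [ k ] says a ≡ ±b (mod 2k): 2k divides a - b or a + b.  (The
-- argument of plus is, by computation, just the ℕ-statement 2k ∣ a + b.)
data _≡±_[_] (a b k : ℕ) : Set where
  minus : + (2 * k) ∣ᵘ (+ a ℤ.- + b) → a ≡± b [ k ]
  plus  : + (2 * k) ∣ᵘ (+ a ℤ.+ + b) → a ≡± b [ k ]

CongKR-heights : ℕ → ℕ → ℕ → Set
CongKR-heights k a b = (+ (2 * k) ∣ᵘ (+ a ℤ.- + b)) ⊎ (+ (2 * k) ∣ᵘ (+ a ℤ.+ + b))

±-fromKR : ∀ {k a b} → CongKR-heights k a b → a ≡± b [ k ]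
±-fromKR (inj₁ p) = minus p
±-fromKR (inj₂ p) = plus p

±-toKR : ∀ {k a b} → a ≡± b [ k ] → CongKR-heights k a b
±-toKR (minus p) = inj₁ p
±-toKR (plus p) = inj₂ p

∣+a-+b∣≡∣a-b∣ : ∀ a b → ℤ.∣ + a ℤ.- + b ∣ ≡ ∣ a - b ∣
∣+a-+b∣≡∣a-b∣ a b with ℕ.≤-total a b
... | inj₁ a≤b = trans (cong ℤ.∣_∣ (ℤ.m-n≡m⊖n a b))
                       (trans (ℤ.∣⊖∣-≤ a≤b) (sym (ℕ.m≤n⇒∣m-n∣≡n∸m a≤b)))
... | inj₂ b≤a = trans (cong ℤ.∣_∣ (trans (ℤ.m-n≡m⊖n a b) (ℤ.⊖-≥ b≤a)))
                       (sym (ℕ.m≤n⇒∣n-m∣≡n∸m b≤a))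

±-by-difference : ∀ k a b → b ≤ a → 2 * k ∣ a ∸ b → a ≡± b [ k ]
±-by-difference k a b b≤a p =
  minus (subst (2 * k ∣_) (sym (trans (∣+a-+b∣≡∣a-b∣ a b) (ℕ.m≤n⇒∣n-m∣≡n∸m b≤a))) p)

-- Signed divisibility is better behaved algebraically; we pass through it
-- for the laws that need ring identities.
private
  toSigned : ∀ {k a b} → a ≡± b [ k ] →
             (+ (2 * k) Signed.∣ (+ a ℤ.- + b)) ⊎ (+ (2 * k) Signed.∣ (+ a ℤ.+ + b))
  toSigned (minus p) = inj₁ (Signed.∣ᵤ⇒∣ p)
  toSigned (plus p) = inj₂ (Signed.∣ᵤ⇒∣ p)

  divides-≡ : ∀ {d} i {j} → i ≡ j → d Signed.∣ j → d ∣ᵘ i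
  divides-≡ _ refl p = Signed.∣⇒∣ᵤ p

  halve : ∀ {k i} → + (2 * k) Signed.∣ i → + k Signed.∣ i
  halve {k} = Signed.∣-trans (Signed.divides (+ 2) (ℤ.pos-* 2 k))

  cast : ∀ {N a} → a ≤ N → + (N ∸ a) ≡ + N ℤ.- + a
  cast {N} {a} a≤N = sym (trans (ℤ.m-n≡m⊖n N a) (ℤ.⊖-≥ a≤N))

±-refl : ∀ {k a} → a ≡± a [ k ]
±-refl {k} {a} = ±-by-difference k a a ℕ.≤-refl (subst (2 * k ∣_) (sym (ℕ.n∸n≡0 a)) (_ ∣0))

±-sym : ∀ {k a b} → a ≡± b [ k ] → b ≡± a [ k ]
±-sym {k} {a} {b} (minus p) = minus (subst (2 * k ∣_) (ℤ.∣i-j∣≡∣j-i∣ (+ a) (+ b)) p)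
±-sym {k} {a} {b} (plus p) = plus (subst (2 * k ∣_) (ℕ.+-comm a b) p)

±-trans : ∀ {k a b c} → a ≡± b [ k ] → b ≡± c [ k ] → a ≡± c [ k ]
±-trans {k} {a} {b} {c} p q with toSigned p | toSigned q
... | inj₁ p | inj₁ q = minus (divides-≡ _ (split (+ a) (+ b) (+ c)) (Signed.∣m∣n⇒∣m+n p q))
  where split : ∀ x y z → x ℤ.- z ≡ (x ℤ.- y) ℤ.+ (y ℤ.- z)
        split = ℤ-solve
... | inj₁ p | inj₂ q = plus (divides-≡ _ (split (+ a) (+ b) (+ c)) (Signed.∣m∣n⇒∣m+n p q))
  where split : ∀ x y z → x ℤ.+ z ≡ (x ℤ.- y) ℤ.+ (y ℤ.+ z)
        split = ℤ-solve
... | inj₂ p | inj₁ q = plus (divides-≡ _ (split (+ a) (+ b) (+ c)) (Signed.∣m∣n⇒∣m-n p q))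
  where split : ∀ x y z → x ℤ.+ z ≡ (x ℤ.+ y) ℤ.- (y ℤ.- z)
        split = ℤ-solve
... | inj₂ p | inj₂ q = minus (divides-≡ _ (split (+ a) (+ b) (+ c)) (Signed.∣m∣n⇒∣m-n p q))
  where split : ∀ x y z → x ℤ.- z ≡ (x ℤ.+ y) ℤ.- (y ℤ.+ z)
        split = ℤ-solve

±-pres-∣ : ∀ {k a c} → k ∣ c → a ≡± c [ k ] → k ∣ a
±-pres-∣ {k} {a} {c} k∣c a≡±c with toSigned a≡±c
... | inj₁ p = divides-≡ (+ a) (split (+ a) (+ c))
                        (Signed.∣m∣n⇒∣m+n (halve {k} p) (Signed.∣ᵤ⇒∣ {i = + c} k∣c))
  where split : ∀ x z → x ≡ (x ℤ.- z) ℤ.+ z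
        split = ℤ-solve
... | inj₂ p = divides-≡ (+ a) (split (+ a) (+ c))
                        (Signed.∣m∣n⇒∣m-n (halve {k} p) (Signed.∣ᵤ⇒∣ {i = + c} k∣c))
  where split : ∀ x z → x ≡ (x ℤ.+ z) ℤ.- z
        split = ℤ-solve

private
  small-multiple : ∀ {k m} → 2 * k ∣ m → m ≤ k → m ≡ 0
  small-multiple {m = zero} _ _ = refl
  small-multiple {k} {suc m} 2k∣m m≤k = ⊥-elim (ℕ.<⇒≱ (ℕ.m<m+n k 0<k) (ℕ.≤-trans (∣⇒≤ 2k∣m) m≤k))
    where
    0<k : 0 < k + 0
    0<k = ℕ.<-≤-trans (s≤s z≤n) (ℕ.≤-trans m≤k (ℕ.m≤m+n k 0))

  saturated : ∀ {k a b} → a ≤ k → b ≤ k → 2 * k ≤ a + b → a ≡ k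
  saturated {k} {a} {b} a≤k b≤k 2k≤a+b with a ℕ.<? k
  ... | no a≮k = ℕ.≤-antisym a≤k (ℕ.≮⇒≥ a≮k)
  ... | yes a<k = ⊥-elim (ℕ.<⇒≱ (ℕ.+-mono-<-≤ a<k b≤k)
                                (subst (_≤ a + b) (cong (_+_ k) (ℕ.+-identityʳ k)) 2k≤a+b))

±-unique : ∀ {k a b} → a ≤ k → b ≤ k → a ≡± b [ k ] → a ≡ b
±-unique {k} {a} {b} a≤k b≤k (minus p) =
  ℕ.∣m-n∣≡0⇒m≡n (small-multiple (subst (2 * k ∣_) (∣+a-+b∣≡∣a-b∣ a b) p)
                                 (ℕ.≤-trans (ℕ.∣m-n∣≤m⊔n a b) (ℕ.⊔-lub a≤k b≤k)))
±-unique {k} {a} {b} a≤k b≤k (plus p) with a + b in a+b≡s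
... | zero = trans (ℕ.m+n≡0⇒m≡0 a a+b≡s) (sym (ℕ.m+n≡0⇒n≡0 a a+b≡s))
... | suc s = trans (saturated a≤k b≤k 2k≤a+b) (sym (saturated b≤k a≤k (subst (2 * k ≤_) (ℕ.+-comm a b) 2k≤a+b)))
  where
  2k≤a+b : 2 * k ≤ a + b
  2k≤a+b = subst (2 * k ≤_) (sym a+b≡s) (∣⇒≤ p)

-- A division a = r + q·2k with remainder r ≤ 2k yields the representative
-- of a in 0,…,k: r itself if r ≤ k, and 2k - r otherwise.
±-from-remainder : ∀ {k a} r q → a ≡ r + q * (2 * k) → r ≤ 2 * k → ∃ λ c → c ≤ k × a ≡± c [ k ]
±-from-remainder {k} r q refl r≤2k with r ≤? k
... | yes r≤k = r , r≤k , ±-by-difference k _ r (ℕ.m≤m+n r _) (subst (2 * k ∣_) (sym (ℕ.m+n∸m≡n r _)) (n∣m*n q))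
... | no r≰k = 2 * k ∸ r , bound , plus (subst (2 * k ∣_) (sym sum) (∣m∣n⇒∣m+n (n∣m*n q) ∣-refl))
  where
  open Relation.Binary.PropositionalEquality.≡-Reasoning
  bound : 2 * k ∸ r ≤ k
  bound = ℕ.≤-trans (ℕ.∸-monoʳ-≤ (2 * k) (ℕ.<⇒≤ (ℕ.≰⇒> r≰k)))
                    (ℕ.≤-reflexive (trans (ℕ.m+n∸m≡n k (k + 0)) (ℕ.+-identityʳ k)))
  sum : r + q * (2 * k) + (2 * k ∸ r) ≡ q * (2 * k) + 2 * k
  sum = begin
    r + q * (2 * k) + (2 * k ∸ r)   ≡⟨ cong (_+ (2 * k ∸ r)) (ℕ.+-comm r (q * (2 * k))) ⟩
    q * (2 * k) + r + (2 * k ∸ r)   ≡⟨ ℕ.+-assoc (q * (2 * k)) r (2 * k ∸ r) ⟩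
    q * (2 * k) + (r + (2 * k ∸ r)) ≡⟨ cong (_+_ (q * (2 * k))) (ℕ.m+[n∸m]≡n r≤2k) ⟩
    q * (2 * k) + 2 * k             ∎

±-canonical : ∀ k .{{_ : NonZero k}} a → ∃ λ c → c ≤ k × a ≡± c [ k ]
±-canonical k@(suc _) a =
  ±-from-remainder (a % (2 * k)) (a / (2 * k)) (m≡m%n+[m/n]*n a (2 * k)) (ℕ.<⇒≤ (m%n<n a (2 * k)))

private
  multiple-below-double : ∀ {k r} → k ∣ r → r < 2 * k → r ≡ 0 ⊎ r ≡ k
  multiple-below-double (divides zero refl) _ = inj₁ refl
  multiple-below-double {k} (divides (suc zero) refl) _ = inj₂ (ℕ.+-identityʳ k)
  multiple-below-double {k} (divides (suc (suc j)) refl) r<2k =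
    ⊥-elim (ℕ.<⇒≱ r<2k (ℕ.+-monoʳ-≤ k (ℕ.+-monoʳ-≤ k z≤n)))

  near-even : ∀ k {a b} X → 2 * k ∣ X → a ≡ X → b ≡ suc a ⊎ suc b ≡ a →
              a ≡± 0 [ k ] × b ≡± 1 [ k ]
  near-even k X 2k∣X refl (inj₁ refl) =
    ±-by-difference k X 0 z≤n 2k∣X , ±-by-difference k (suc X) 1 (s≤s z≤n) 2k∣X
  near-even k {b = b} X 2k∣X refl (inj₂ b+1≡X) =
    ±-by-difference k X 0 z≤n 2k∣X ,
    plus (subst (2 * k ∣_) (sym (trans (ℕ.+-comm b 1) b+1≡X)) 2k∣X)

  near-odd : ∀ k0 {a b} X → let k = suc k0 in 2 * k ∣ X → a ≡ k + X → b ≡ suc a ⊎ suc b ≡ a →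
             a ≡± k [ k ] × b ≡± k0 [ k ]
  near-odd k0 X 2k∣X refl (inj₁ refl) =
    ±-by-difference k (k + X) k (ℕ.m≤m+n k X) (subst (2 * k ∣_) (sym (ℕ.m+n∸m≡n k X)) 2k∣X) ,
    plus (subst (2 * k ∣_) (sym (wrap k0 X)) (∣m∣n⇒∣m+n 2k∣X ∣-refl))
    where
    k = suc k0
    wrap : ∀ k0 X → suc (suc k0 + X) + k0 ≡ X + 2 * suc k0
    wrap = ℕ-solve
  near-odd k0 X 2k∣X refl (inj₂ refl) =
    ±-by-difference k (k + X) k (ℕ.m≤m+n k X) (subst (2 * k ∣_) (sym (ℕ.m+n∸m≡n k X)) 2k∣X) ,
    ±-by-difference k (k0 + X) k0 (ℕ.m≤m+n k0 X) (subst (2 * k ∣_) (sym (ℕ.m+n∸m≡n k0 X)) 2k∣X)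
    where
    k = suc k0

±-near-multiple : ∀ k .{{_ : NonZero k}} {a b} → k ∣ a → b ≡ suc a ⊎ suc b ≡ a →
                  (a ≡± 0 [ k ] × b ≡± 1 [ k ]) ⊎ (a ≡± k [ k ] × b ≡± pred k [ k ])
±-near-multiple k@(suc k0) {a} {b} k∣a b≡a±1 =
  near (multiple-below-double (%-presˡ-∣ k∣a (n∣m*n 2)) (m%n<n a (2 * k))) (m≡m%n+[m/n]*n a (2 * k))
  where
  X : ℕ
  X = a / (2 * k) * (2 * k)
  near : a % (2 * k) ≡ 0 ⊎ a % (2 * k) ≡ k → a ≡ a % (2 * k) + X →
         (a ≡± 0 [ k ] × b ≡± 1 [ k ]) ⊎ (a ≡± k [ k ] × b ≡± k0 [ k ])
  near (inj₁ r≡0) a≡r+X = inj₁ (near-even k X (n∣m*n (a / (2 * k))) (trans a≡r+X (cong (_+ X) r≡0)) b≡a±1)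
  near (inj₂ r≡k) a≡r+X = inj₂ (near-odd k0 X (n∣m*n (a / (2 * k))) (trans a≡r+X (cong (_+ X) r≡k)) b≡a±1)

±-reflect : ∀ {k N a b} → k ∣ N → a ≤ N → b ≤ N → a ≡± b [ k ] → N ∸ a ≡± N ∸ b [ k ]
±-reflect {k} {N} {a} {b} k∣N a≤N b≤N a≡±b with toSigned a≡±b
... | inj₁ p = minus (divides-≡ _ eq (Signed.∣m⇒∣-m p))
  where
  reflect : ∀ n x y → (n ℤ.- x) ℤ.- (n ℤ.- y) ≡ ℤ.- (x ℤ.- y)
  reflect = ℤ-solve
  eq : + (N ∸ a) ℤ.- + (N ∸ b) ≡ ℤ.- (+ a ℤ.- + b)
  eq = trans (cong₂ ℤ._-_ (cast a≤N) (cast b≤N)) (reflect (+ N) (+ a) (+ b))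
... | inj₂ p = plus (divides-≡ _ eq (Signed.∣m∣n⇒∣m-n 2k∣2N p))
  where
  reflect : ∀ n x y → (n ℤ.- x) ℤ.+ (n ℤ.- y) ≡ (n ℤ.+ n) ℤ.- (x ℤ.+ y)
  reflect = ℤ-solve
  eq : + (N ∸ a) ℤ.+ + (N ∸ b) ≡ (+ N ℤ.+ + N) ℤ.- (+ a ℤ.+ + b)
  eq = trans (cong₂ ℤ._+_ (cast a≤N) (cast b≤N)) (reflect (+ N) (+ a) (+ b))
  2k∣2N : + (2 * k) Signed.∣ (+ N ℤ.+ + N)
  2k∣2N = Signed.∣ᵤ⇒∣ (subst (2 * k ∣_) (cong (_+_ N) (ℕ.+-identityʳ N)) (*-monoʳ-∣ 2 k∣N))

-- Counting the r̄-entries below x.  Since Δ is defined with the Boolean order,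
-- we first relate _<ᵇ_ to _<_ at the points where Δ changes.
private
  <ᵇ-irrefl : ∀ r → (r <ᵇ r) ≡ false
  <ᵇ-irrefl zero = refl
  <ᵇ-irrefl (suc r) = <ᵇ-irrefl r

  <ᵇ-true : ∀ {r x} → r < x → (r <ᵇ x) ≡ true
  <ᵇ-true r<x = Equivalence.to T-≡ (ℕ.<⇒<ᵇ r<x)

  <ᵇ-suc : ∀ r x → r ≢ x → (r <ᵇ suc x) ≡ (r <ᵇ x)
  <ᵇ-suc zero zero r≢x = ⊥-elim (r≢x refl)
  <ᵇ-suc zero (suc x) _ = refl
  <ᵇ-suc (suc r) zero _ = refl
  <ᵇ-suc (suc r) (suc x) r≢x = <ᵇ-suc r x (λ r≡x → r≢x (cong suc r≡x))

Δ-zero : ∀ rs → Δ rs 0 ≡ 0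
Δ-zero [] = refl
Δ-zero (r ∷ rs) = Δ-zero rs

Δ-step-∉ : ∀ rs x → x ∉ rs → Δ rs (suc x) ≡ Δ rs x
Δ-step-∉ [] x _ = refl
Δ-step-∉ (r ∷ rs) x x∉ =
  cong₂ (λ b d → (if b then 1 else 0) + d) (<ᵇ-suc r x (λ r≡x → x∉ (here (sym r≡x))))
        (Δ-step-∉ rs x (λ x∈ → x∉ (there x∈)))

Δ-step-∈ : ∀ {rs x} → AllPairs _<_ rs → x ∈ rs → Δ rs (suc x) ≡ suc (Δ rs x)
Δ-step-∈ {r ∷ rs} (above ∷ _) (here refl) rewrite <ᵇ-irrefl r | <ᵇ-true (ℕ.n<1+n r) =
  cong suc (Δ-step-∉ rs r (λ r∈ → ℕ.<-irrefl refl (All.lookup above r∈)))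
Δ-step-∈ {r ∷ rs} {x} (above ∷ pairs) (there x∈) rewrite <ᵇ-true (All.lookup above x∈)
                                                        | <ᵇ-true (ℕ.m<n⇒m<1+n (All.lookup above x∈)) =
  cong suc (Δ-step-∈ pairs x∈)

Δ-all-below : ∀ rs x → All (_< x) rs → Δ rs x ≡ length rs
Δ-all-below [] x _ = refl
Δ-all-below (r ∷ rs) x (r<x ∷ below) rewrite <ᵇ-true r<x = cong suc (Δ-all-below rs x below)

-- The collapsed coordinate t x = x - Δ(x) of ⟨k;r̄⟩: the relation ⟨k;r̄⟩ only
-- looks at t, which starts at 0, stays put across each entry of r̄ (a
-- "stutter") and otherwise advances by one.
module Collapse (rs : List ℕ) (inc : StrictlyIncreasing rs) where

  t : ℕ → ℕ
  t x = x ∸ Δ rs x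

  private
    pairs : AllPairs _<_ rs
    pairs = Linked⇒AllPairs ℕ.<-trans inc

  -- Δ(x) ≤ x, so that t (x + 1) = t x + 1 at a non-entry x.
  Δ-≤ : ∀ x → Δ rs x ≤ x
  Δ-≤ zero = ℕ.≤-reflexive (Δ-zero rs)
  Δ-≤ (suc x) with x ∈? rs
  ... | yes x∈ = subst (_≤ suc x) (sym (Δ-step-∈ pairs x∈)) (s≤s (Δ-≤ x))
  ... | no x∉ = subst (_≤ suc x) (sym (Δ-step-∉ rs x x∉)) (ℕ.m≤n⇒m≤1+n (Δ-≤ x))

  t-zero : t 0 ≡ 0
  t-zero = ℕ.0∸n≡0 (Δ rs 0)

  t-stutter : ∀ {x} → x ∈ rs → t (suc x) ≡ t x
  t-stutter {x} x∈ = cong (suc x ∸_) (Δ-step-∈ pairs x∈)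

  t-advance : ∀ {x} → x ∉ rs → t (suc x) ≡ suc (t x)
  t-advance {x} x∉ = trans (cong (suc x ∸_) (Δ-step-∉ rs x x∉)) (ℕ.+-∸-assoc 1 (Δ-≤ x))

  t-up : ∀ x → t x ≤ t (suc x)
  t-up x with x ∈? rs
  ... | yes x∈ = ℕ.≤-reflexive (sym (t-stutter x∈))
  ... | no x∉ = subst (t x ≤_) (sym (t-advance x∉)) (ℕ.n≤1+n (t x))

  t-unit-step : ∀ x → t (suc x) ≤ suc (t x)
  t-unit-step x with x ∈? rs
  ... | yes x∈ = subst (_≤ suc (t x)) (sym (t-stutter x∈)) (ℕ.n≤1+n (t x))
  ... | no x∉ = ℕ.≤-reflexive (t-advance x∉)

  t-mono : ∀ {x y} → x ≤ y → t x ≤ t y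
  t-mono x≤y = mono′ (ℕ.≤⇒≤′ x≤y)
    where
    mono′ : ∀ {x y} → x ≤′ y → t x ≤ t y
    mono′ ≤′-refl = ℕ.≤-refl
    mono′ (≤′-step x≤′y) = ℕ.≤-trans (mono′ x≤′y) (t-up _)

  t-≤ : ∀ x → t x ≤ x
  t-≤ x = ℕ.m∸n≤m x (Δ rs x)

  t-after-all : ∀ x → All (_< x) rs → t x ≡ x ∸ length rs
  t-after-all x below = cong (x ∸_) (Δ-all-below rs x below)

  t-crosses : ∀ m v → v < t m → ∃ λ p → p < m × t p ≡ v × t (suc p) ≡ suc v
  t-crosses zero v v<t0 = ⊥-elim (ℕ.n≮0 (subst (v <_) t-zero v<t0))
  t-crosses (suc m) v v<t with v ℕ.<? t m
  ... | yes v<tm with t-crosses m v v<tm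
  ...   | p , p<m , tp≡v , tsp≡sv = p , ℕ.m<n⇒m<1+n p<m , tp≡v , tsp≡sv
  t-crosses (suc m) v v<t | no v≮tm =
    m , ℕ.n<1+n m , tm≡v , ℕ.≤-antisym (subst (λ u → t (suc m) ≤ suc u) tm≡v (t-unit-step m)) v<t
    where
    tm≡v : t m ≡ v
    tm≡v = ℕ.≤-antisym (ℕ.≮⇒≥ v≮tm) (ℕ.≤-pred (ℕ.≤-trans v<t (t-unit-step m)))

adj-suc : ∀ x → Adj x (suc x)
adj-suc x = ℕ.m≤n⇒m≤1+n (ℕ.n≤1+n x) , ℕ.≤-refl

adj-pred : ∀ x → Adj (suc x) x
adj-pred x = ℕ.≤-refl , ℕ.m≤n⇒m≤1+n (ℕ.n≤1+n x)

suc-∸ : ∀ {n j} → suc j ≤ n → suc (n ∸ suc j) ≡ n ∸ j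
suc-∸ sj≤n = sym (ℕ.+-∸-assoc 1 sj≤n)

Zig : ℕ → Relation → Set
Zig n θ = ∀ {x x' y} → y ≤ n → θ x' x → Adj x y → Σ ℕ λ y' → (y' ≤ n) × Adj x' y' × θ y' y

-- The shape of the collapsed coordinate t of a relation θ = ⟨k;r̄⟩ (k ≥ 1)
-- with the back-and-forth property.  Its classes are the ±-classes of t
-- modulo 2k, represented by 0,…,k.
module ZigKR (n k0 : ℕ) (rs : List ℕ) (inc : StrictlyIncreasing rs)
             (zig : Zig n (CongKR n (suc k0) rs)) where

  open Collapse rs inc public

  k : ℕ
  k = suc k0

  θ : Relation
  θ = CongKR n k rs

  -- If θ has k + 1 classes then t climbs at least to k: otherwise t, which
  -- determines the class, takes fewer than k + 1 values.
  classes⇒k≤tn : NumClasses n θ (suc k) → k ≤ t n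
  classes⇒k≤tn (rep , rep≤n , rep-distinct , _) with k ≤? t n
  ... | yes k≤tn = k≤tn
  ... | no k≰tn with Fin.pigeonhole (s≤s (ℕ.≰⇒> k≰tn)) value
    where
    value : Fin (suc k) → Fin (suc (t n))
    value i = Fin.fromℕ< (s≤s (t-mono (rep≤n i)))
  ... | i , j , i<j , same-value = ⊥-elim (ℕ.<-irrefl (cong Fin.toℕ (rep-distinct i j θij)) i<j)
    where
    same-t : t (rep i) ≡ t (rep j)
    same-t = trans (sym (Fin.toℕ-fromℕ< _)) (trans (cong Fin.toℕ same-value) (Fin.toℕ-fromℕ< _))
    θij : θ (rep i) (rep j)
    θij = rep≤n i , rep≤n j , ±-toKR (subst (λ v → t (rep i) ≡± v [ k ]) same-t ±-refl)

  module Rigid (k≤tn : k ≤ t n) where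

    k≤n : k ≤ n
    k≤n = ℕ.≤-trans k≤tn (t-≤ n)

    -- t does not stutter before reaching k: at the first stutter x < k, the
    -- point x would be θ-related to a later point p where t advances from x
    -- to x + 1, and the back-and-forth condition fails at p + 1.
    no-early-stutter : ∀ {x} → suc x ≤ k → t x ≡ x → t (suc x) ≡ t x → ⊥
    no-early-stutter {x} sx≤k tx≡x stutter with t-crosses n x (ℕ.<-≤-trans sx≤k k≤tn)
    ... | p , p<n , tp≡x , tsp≡sx with zig p<n θxp (adj-suc p)
      where
      θxp : θ x p
      θxp = ℕ.≤-trans (ℕ.<⇒≤ sx≤k) k≤n , ℕ.<⇒≤ p<n ,
            ±-toKR (subst (λ v → t x ≡± v [ k ]) (trans tx≡x (sym tp≡x)) ±-refl)
    ... | y , _ , (_ , y≤sx) , (_ , _ , ty≡±tsp) = ℕ.<-irrefl refl (subst (_≤ x) ty≡sx ty≤x)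
      where
      ty≤x : t y ≤ x
      ty≤x = ℕ.≤-trans (t-mono y≤sx) (ℕ.≤-reflexive (trans stutter tx≡x))
      ty≡sx : t y ≡ suc x
      ty≡sx = ±-unique (ℕ.≤-trans ty≤x (ℕ.<⇒≤ sx≤k)) sx≤k
                       (subst (λ v → t y ≡± v [ k ]) tsp≡sx (±-fromKR ty≡±tsp))

    t-initial : ∀ {x} → x ≤ k → t x ≡ x
    t-initial {zero} _ = t-zero
    t-initial {suc x} sx≤k with x ∈? rs
    ... | yes x∈ = ⊥-elim (no-early-stutter sx≤k (t-initial (ℕ.<⇒≤ sx≤k)) (t-stutter x∈))
    ... | no x∉ = trans (t-advance x∉) (cong suc (t-initial (ℕ.<⇒≤ sx≤k)))

    -- On 0,…,k the coordinate t is the identity, so θ relates a point to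
    -- the canonical representative of its t-value.
    θ-canonical : ∀ {x c} → x ≤ n → c ≤ k → t x ≡± c [ k ] → θ x c
    θ-canonical {x} x≤n c≤k tx≡±c =
      x≤n , ℕ.≤-trans c≤k k≤n , ±-toKR (subst (λ v → t x ≡± v [ k ]) (sym (t-initial c≤k)) tx≡±c)

    θ-canonical⁻¹ : ∀ {y c} → c ≤ k → θ y c → t y ≡± c [ k ]
    θ-canonical⁻¹ {y} c≤k (_ , _ , ty≡±tc) = subst (λ v → t y ≡± v [ k ]) (t-initial c≤k) (±-fromKR ty≡±tc)

    other-neighbour : ∀ c → c ≤ k → ∃ λ c' → c' ≤ k × Adj c c' × c ≢ c'
    other-neighbour zero _ = 1 , s≤s z≤n , adj-suc 0 , (λ ())
    other-neighbour (suc c) sc≤k = c , ℕ.≤-trans (ℕ.n≤1+n c) sc≤k , adj-pred c , ℕ.1+n≢n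

    shifted-neighbour : ∀ {x c c'} → x ≤ n → c ≤ k → t x ≡± c [ k ] →
                        c' ≤ k → Adj c c' → c ≢ c' →
                        ∃ λ y → y ≤ n × Adj x y × t y ≢ t x × t y ≡± c' [ k ]
    shifted-neighbour {x} {c} {c'} x≤n c≤k tx≡±c c'≤k adj c≢c'
      with zig (ℕ.≤-trans c'≤k k≤n) (θ-canonical x≤n c≤k tx≡±c) adj
    ... | y , y≤n , x~y , θyc' = y , y≤n , x~y , moved , ty≡±c'
      where
      ty≡±c' : t y ≡± c' [ k ]
      ty≡±c' = θ-canonical⁻¹ c'≤k θyc'
      moved : t y ≢ t x
      moved ty≡tx = c≢c' (±-unique c≤k c'≤k
        (±-trans (±-sym tx≡±c) (subst (λ v → v ≡± c' [ k ]) ty≡tx ty≡±c')))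

    no-plateau : ∀ {x} → x ≤ n → (∀ y → y ≤ n → Adj x y → t y ≡ t x) → ⊥
    no-plateau {x} x≤n flat with ±-canonical k (t x)
    ... | c , c≤k , tx≡±c with other-neighbour c c≤k
    ...   | c' , c'≤k , adj , c≢c' with shifted-neighbour x≤n c≤k tx≡±c c'≤k adj c≢c'
    ...     | y , y≤n , x~y , moved , _ = moved (flat y y≤n x~y)

    -- A "kink" is a point whose neighbours all lie at its own height or one
    -- below; stutter points and the end point n are kinks.
    Kink : ℕ → Set
    Kink x = ∀ y → y ≤ n → Adj x y → t y ≤ t x × t x ≤ suc (t y)

    -- At a kink x, a representative c + 1 strictly inside 0,…,k is impossible:
    -- its neighbours c and c + 2 would both have to be represented one step
    -- below t x, forcing c ≡± c + 2.
    kink-not-inner : ∀ {x c} → x ≤ n → Kink x → suc (suc c) ≤ k → t x ≡± suc c [ k ] → ⊥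
    kink-not-inner {x} {c} x≤n kink ssc≤k tx≡±sc =
      clash (shifted-neighbour x≤n (ℕ.<⇒≤ ssc≤k) tx≡±sc c≤k (adj-pred c) ℕ.1+n≢n)
            (shifted-neighbour x≤n (ℕ.<⇒≤ ssc≤k) tx≡±sc ssc≤k (adj-suc (suc c)) (ℕ.1+n≢n ∘ sym))
      where
      c≤k : c ≤ k
      c≤k = ℕ.≤-trans (ℕ.n≤1+n c) (ℕ.<⇒≤ ssc≤k)
      one-below : ∀ {y} → Adj x y → y ≤ n → t y ≢ t x → suc (t y) ≡ t x
      one-below {y} x~y y≤n moved with kink y y≤n x~y
      ... | ty≤tx , tx≤sty = ℕ.≤-antisym (ℕ.≤∧≢⇒< ty≤tx moved) tx≤sty
      clash : (∃ λ y → y ≤ n × Adj x y × t y ≢ t x × t y ≡± c [ k ]) →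
              (∃ λ y → y ≤ n × Adj x y × t y ≢ t x × t y ≡± suc (suc c) [ k ]) → ⊥
      clash (y₋ , y₋≤n , x~y₋ , moved₋ , ty₋≡±c) (y₊ , y₊≤n , x~y₊ , moved₊ , ty₊≡±ssc) =
        ℕ.m≢1+n+m c {1} (±-unique c≤k ssc≤k
          (±-trans (±-sym ty₋≡±c) (subst (λ v → v ≡± suc (suc c) [ k ]) same-height ty₊≡±ssc)))
        where
        same-height : t y₊ ≡ t y₋
        same-height = ℕ.suc-injective (trans (one-below x~y₊ y₊≤n moved₊) (sym (one-below x~y₋ y₋≤n moved₋)))

    -- Hence the height of a kink is a multiple of k (its representative is 0 or k).
    kink-divisible : ∀ {x} → x ≤ n → Kink x → k ∣ t x
    kink-divisible {x} x≤n kink with ±-canonical k (t x)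
    ... | zero , _ , tx≡±0 = ±-pres-∣ (_ ∣0) tx≡±0
    ... | suc c , sc≤k , tx≡±sc with suc c ℕ.≟ k
    ...   | yes refl = ±-pres-∣ ∣-refl tx≡±sc
    ...   | no sc≢k = ⊥-elim (kink-not-inner x≤n kink (ℕ.≤∧≢⇒< sc≤k sc≢k) tx≡±sc)

    stutter-divisible : ∀ {x} → x ∈ rs → suc x ≤ n → k ∣ t x
    stutter-divisible {x} x∈ sx≤n = kink-divisible (ℕ.≤-trans (ℕ.n≤1+n x) sx≤n) kink
      where
      kink : Kink x
      kink y _ (x≤sy , y≤sx) = ℕ.≤-trans (t-mono y≤sx) (ℕ.≤-reflexive (t-stutter x∈)) ,
                               ℕ.≤-trans (t-mono x≤sy) (t-unit-step y)

    k∣tn : k ∣ t n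
    k∣tn = kink-divisible ℕ.≤-refl kink
      where
      kink : Kink n
      kink y y≤n (n≤sy , _) = t-mono y≤n , ℕ.≤-trans (t-mono n≤sy) (t-unit-step y)

    -- Symmetrically, t does not stutter in the last k steps: a stutter just
    -- below n would make n a plateau, and a stutter at n - (j + 1) with
    -- 1 ≤ j < k would put the multiple t n - j of k at distance j from the
    -- multiple t n.
    no-late-stutter : ∀ {j} → suc j ≤ k → suc j ≤ n → t (n ∸ j) + j ≡ t n → n ∸ suc j ∈ rs → ⊥
    no-late-stutter {zero} _ 1≤n _ p∈ = no-plateau ℕ.≤-refl flat
      where
      flat : ∀ y → y ≤ n → Adj n y → t y ≡ t n
      flat y y≤n (n≤sy , _) = ℕ.≤-antisym (t-mono y≤n)
        (ℕ.≤-trans (ℕ.≤-reflexive (trans (cong t (sym (suc-∸ 1≤n))) (t-stutter p∈)))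
                   (t-mono (subst (_≤ y) (ℕ.pred[m∸n]≡m∸[1+n] n 0) (ℕ.pred-mono-≤ n≤sy))))
    no-late-stutter {suc j} ssj≤k ssj≤n sum p∈ =
      ℕ.<⇒≱ ssj≤k (∣⇒≤ (∣m+n∣m⇒∣n (subst (k ∣_) (sym sum) k∣tn) k∣t[n-sj]))
      where
      k∣t[n-sj] : k ∣ t (n ∸ suc j)
      k∣t[n-sj] = subst (k ∣_) (trans (sym (t-stutter p∈)) (cong t (suc-∸ ssj≤n)))
        (stutter-divisible p∈ (subst (_≤ n) (sym (suc-∸ ssj≤n)) (ℕ.m∸n≤m n (suc j))))

    t-final : ∀ {j} → j ≤ k → j ≤ n → t (n ∸ j) + j ≡ t n
    t-final {zero} _ _ = ℕ.+-identityʳ (t n)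
    t-final {suc j} sj≤k sj≤n
      with n ∸ suc j ∈? rs | t-final (ℕ.≤-trans (ℕ.n≤1+n j) sj≤k) (ℕ.≤-trans (ℕ.n≤1+n j) sj≤n)
    ... | yes p∈ | previous = ⊥-elim (no-late-stutter sj≤k sj≤n previous p∈)
    ... | no p∉ | previous = begin
      t (n ∸ suc j) + suc j     ≡⟨ ℕ.+-suc (t (n ∸ suc j)) j ⟩
      suc (t (n ∸ suc j)) + j   ≡⟨ cong (_+ j) (sym (t-advance p∉)) ⟩
      t (suc (n ∸ suc j)) + j   ≡⟨ cong (λ z → t z + j) (suc-∸ sj≤n) ⟩
      t (n ∸ j) + j             ≡⟨ previous ⟩
      t n                       ∎
      where open Relation.Binary.PropositionalEquality.≡-Reasoning

-- Its
-- coordinate t rises from 0 to 2k, without stutters in the first and the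
-- last k steps, and with at most one stutter in between; hence
-- t x + t (n - x) = 2k, and δ relates x only to x and to n - x.
module FrequencyTwo (n : ℕ) (δ : Relation) (cδ : IsCongruence n δ)
                    (k0 : ℕ) (rs : List ℕ) (inc : StrictlyIncreasing rs) (below-n : All (_< n) rs)
                    (δ≈KR : SameOn n δ (CongKR n (suc k0) rs)) (length≡2k : n ∸ length rs ≡ 2 * suc k0) where

  private
    δ⇒KR : ∀ {x y} → x ≤ n → y ≤ n → δ x y → CongKR n (suc k0) rs x y
    δ⇒KR {x} {y} x≤n y≤n = Equivalence.to (δ≈KR x y x≤n y≤n)

    KR⇒δ : ∀ {x y} → CongKR n (suc k0) rs x y → δ x y
    KR⇒δ {x} {y} xy@(x≤n , y≤n , _) = Equivalence.from (δ≈KR x y x≤n y≤n) xy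

    zig-KR : Zig n (CongKR n (suc k0) rs)
    zig-KR y≤n xy adj with IsCongruence.zig cδ y≤n (KR⇒δ xy) adj
    ... | y' , y'≤n , adj' , δy'y = y' , y'≤n , adj' , δ⇒KR y'≤n y≤n δy'y

  open ZigKR n k0 rs inc zig-KR

  tn≡2k : t n ≡ 2 * k
  tn≡2k = trans (t-after-all n below-n) length≡2k

  open Rigid (subst (k ≤_) (sym tn≡2k) (ℕ.m≤m+n k (k + 0)))

  t[n-k]≡k : t (n ∸ k) ≡ k
  t[n-k]≡k = ℕ.+-cancelʳ-≡ k (t (n ∸ k)) k
               (trans (t-final ℕ.≤-refl k≤n) (trans tn≡2k (cong (_+_ k) (ℕ.+-identityʳ k))))

  -- Between k and n - k the coordinate stays at height k, so that stretch
  -- has length at most one: two steps would create a plateau at k + 1.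
  middle-short : n ∸ k ≤ suc k
  middle-short with n ∸ k ≤? suc k
  ... | yes short = short
  ... | no long = ⊥-elim (no-plateau sk≤n flat)
    where
    ssk≤n-k : suc (suc k) ≤ n ∸ k
    ssk≤n-k = ℕ.≰⇒> long
    sk≤n : suc k ≤ n
    sk≤n = ℕ.≤-trans (ℕ.n≤1+n (suc k)) (ℕ.≤-trans ssk≤n-k (ℕ.m∸n≤m n k))
    at-height-k : ∀ {y} → k ≤ y → y ≤ n ∸ k → t y ≡ k
    at-height-k {y} k≤y y≤n-k = ℕ.≤-antisym (subst (t y ≤_) t[n-k]≡k (t-mono y≤n-k))
                                            (subst (_≤ t y) (t-initial ℕ.≤-refl) (t-mono k≤y))
    flat : ∀ y → y ≤ n → Adj (suc k) y → t y ≡ t (suc k)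
    flat y _ (sk≤sy , y≤ssk) = trans (at-height-k (ℕ.≤-pred sk≤sy) (ℕ.≤-trans y≤ssk ssk≤n-k))
                                     (sym (at-height-k (ℕ.n≤1+n k) (ℕ.≤-trans (ℕ.n≤1+n (suc k)) ssk≤n-k)))

  far : ∀ {x} → k < x → n ∸ x ≤ k
  far k<x = ℕ.≤-trans (ℕ.∸-monoʳ-≤ n k<x)
                      (subst (_≤ k) (ℕ.pred[m∸n]≡m∸[1+n] n k) (ℕ.pred-mono-≤ middle-short))

  heights-sum : ∀ {x} → x ≤ n → t x + t (n ∸ x) ≡ 2 * k
  heights-sum {x} x≤n with x ≤? k
  ... | yes x≤k = begin
    t x + t (n ∸ x)   ≡⟨ ℕ.+-comm (t x) (t (n ∸ x)) ⟩
    t (n ∸ x) + t x   ≡⟨ cong (_+_ (t (n ∸ x))) (t-initial x≤k) ⟩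
    t (n ∸ x) + x     ≡⟨ t-final x≤k x≤n ⟩
    t n               ≡⟨ tn≡2k ⟩
    2 * k             ∎
    where open Relation.Binary.PropositionalEquality.≡-Reasoning
  ... | no x≰k = begin
    t x + t (n ∸ x)               ≡⟨ cong (λ z → t z + t (n ∸ x)) (sym (ℕ.m∸[m∸n]≡n x≤n)) ⟩
    t (n ∸ (n ∸ x)) + t (n ∸ x)   ≡⟨ cong (_+_ (t (n ∸ (n ∸ x)))) (t-initial n-x≤k) ⟩
    t (n ∸ (n ∸ x)) + (n ∸ x)     ≡⟨ t-final n-x≤k (ℕ.m∸n≤m n x) ⟩
    t n                           ≡⟨ tn≡2k ⟩
    2 * k                         ∎
    where
    open Relation.Binary.PropositionalEquality.≡-Reasoning
    n-x≤k : n ∸ x ≤ k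
    n-x≤k = far (ℕ.≰⇒> x≰k)

  representative : ∀ {x} → x ≤ n → ∃ λ c → c ≤ k × t x ≡± c [ k ] × (c ≡ x ⊎ c + x ≡ n)
  representative {x} x≤n with x ≤? k
  ... | yes x≤k = x , x≤k , subst (λ v → t x ≡± v [ k ]) (t-initial x≤k) ±-refl , inj₁ refl
  ... | no x≰k = n ∸ x , n-x≤k , plus 2k∣sum , inj₂ (ℕ.m∸n+n≡m x≤n)
    where
    n-x≤k : n ∸ x ≤ k
    n-x≤k = far (ℕ.≰⇒> x≰k)
    2k∣sum : 2 * k ∣ t x + (n ∸ x)
    2k∣sum = subst (λ v → 2 * k ∣ t x + v) (t-initial n-x≤k) (subst (2 * k ∣_) (sym (heights-sum x≤n)) ∣-refl)

  -- δ relates x only to x and to n - x (their representatives must agree) ...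
  δ-sound : ∀ {x y} → δ x y → x ≡ y ⊎ x + y ≡ n
  δ-sound {x} {y} δxy with IsCongruence.dom cδ δxy
  ... | x≤n , y≤n with representative x≤n | representative y≤n
  ... | c , c≤k , tx≡±c , c~x | c' , c'≤k , ty≡±c' , c'~y =
    combine c~x (subst (λ d → d ≡ y ⊎ d + y ≡ n) (sym same-rep) c'~y)
    where
    tx≡±ty : t x ≡± t y [ k ]
    tx≡±ty = ±-fromKR (proj₂ (proj₂ (δ⇒KR x≤n y≤n δxy)))
    same-rep : c ≡ c'
    same-rep = ±-unique c≤k c'≤k (±-trans (±-sym tx≡±c) (±-trans tx≡±ty ty≡±c'))
    combine : c ≡ x ⊎ c + x ≡ n → c ≡ y ⊎ c + y ≡ n → x ≡ y ⊎ x + y ≡ n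
    combine (inj₁ c≡x) (inj₁ c≡y) = inj₁ (trans (sym c≡x) c≡y)
    combine (inj₁ c≡x) (inj₂ c+y≡n) = inj₂ (trans (cong (_+ y) (sym c≡x)) c+y≡n)
    combine (inj₂ c+x≡n) (inj₁ c≡y) = inj₂ (trans (cong (_+_ x) (sym c≡y)) (trans (ℕ.+-comm x c) c+x≡n))
    combine (inj₂ c+x≡n) (inj₂ c+y≡n) = inj₁ (ℕ.+-cancelˡ-≡ c x y (trans c+x≡n (sym c+y≡n)))

  δ-complement : ∀ {x y} → x + y ≡ n → δ x y
  δ-complement {x} {y} refl =
    KR⇒δ (ℕ.m≤m+n x y , ℕ.m≤n+m y x ,
          ±-toKR {k} {t x} {t y} (plus (subst (2 * k ∣_) (sym sum) ∣-refl)))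
    where
    sum : t x + t y ≡ 2 * k
    sum = subst (λ z → t x + t z ≡ 2 * k) (ℕ.m+n∸m≡n x y) (heights-sum (ℕ.m≤m+n x y))

-- The join of two congruences inherits the back-and-forth condition, and
-- it is all of {0,…,n}² as soon as one point is joined to all its neighbours.
module Joins (n : ℕ) (θ δ : Relation) (cθ : IsCongruence n θ) (cδ : IsCongruence n δ) where

  J : Relation
  J = Join n θ δ

  Transfer : ℕ → ℕ → Set
  Transfer x y = ∀ {w} → w ≤ n → Adj y w → ∃ λ w' → w' ≤ n × Adj x w' × J w' w

  private
    congruence-transfer : ∀ {R} → IsCongruence n R → (∀ {x y} → x ≤ n → y ≤ n → R x y → J x y) →
                          ∀ {x y} → R x y → Transfer x y × Transfer y x
    congruence-transfer {R} cR embed Rxy = forth Rxy , forth (IsCongruence.sym cR Rxy)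
      where
      forth : ∀ {x y} → R x y → Transfer x y
      forth Rxy w≤n adj with IsCongruence.zig cR w≤n Rxy adj
      ... | w' , w'≤n , adj' , Rw'w = w' , w'≤n , adj' , embed w'≤n w≤n Rw'w

  join-transfer : ∀ {x y} → J x y → Transfer x y × Transfer y x
  join-transfer (inl _ _ θxy) = congruence-transfer cθ inl θxy
  join-transfer (inr _ _ δxy) = congruence-transfer cδ inr δxy
  join-transfer (join-refl _) = stay , stay
    where
    stay : ∀ {x} → Transfer x x
    stay {w = w} w≤n adj = w , w≤n , adj , join-refl w≤n
  join-transfer (join-sym Jyx) with join-transfer Jyx
  ... | forth , back = back , forth
  join-transfer (join-trans Jxy Jyz) with join-transfer Jxy | join-transfer Jyz
  ... | forth₁ , back₁ | forth₂ , back₂ = compose forth₁ forth₂ , compose back₂ back₁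
    where
    compose : ∀ {x y z} → Transfer x y → Transfer y z → Transfer x z
    compose T₁ T₂ w≤n adj with T₂ w≤n adj
    ... | w' , w'≤n , adj' , Jw'w with T₁ w'≤n adj'
    ...   | w'' , w''≤n , adj'' , Jw''w' = w'' , w''≤n , adj'' , join-trans Jw''w' Jw'w

  -- If a is J-related to all its neighbours, the J-class of a is closed
  -- under adjacency and hence, L_n being connected, is everything.
  spread : ∀ {a} → a ≤ n → (∀ y → y ≤ n → Adj a y → J a y) → IsTotal n J
  spread {a} a≤n near u v u≤n v≤n = join-trans (join-sym (reach u u≤n)) (reach v v≤n)
    where
    step : ∀ {x w} → J a x → w ≤ n → Adj x w → J a w
    step Jax w≤n adj with proj₁ (join-transfer Jax) w≤n adj
    ... | w' , w'≤n , adj' , Jw'w = join-trans (near w' w'≤n adj') Jw'w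
    down : ∀ x → x ≤ n → J a x → J a 0
    down zero _ Ja0 = Ja0
    down (suc x) sx≤n Jasx = down x x≤n (step Jasx x≤n (adj-pred x))
      where
      x≤n : x ≤ n
      x≤n = ℕ.≤-trans (ℕ.n≤1+n x) sx≤n
    reach : ∀ x → x ≤ n → J a x
    reach zero _ = down a a≤n (join-refl a≤n)
    reach (suc x) sx≤n = step (reach x (ℕ.≤-trans (ℕ.n≤1+n x) sx≤n)) sx≤n (adj-suc x)

first-failure : ∀ {P Q : ℕ → Set} → (∀ x → P x ⊎ Q x) → ∀ b →
                (∀ x → x < b → P x) ⊎ (∃ λ x₀ → x₀ < b × (∀ x → x < x₀ → P x) × Q x₀)
first-failure decide zero = inj₁ (λ _ ())
first-failure {P} decide (suc b) with first-failure decide b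
... | inj₂ (x₀ , x₀<b , before , Qx₀) = inj₂ (x₀ , ℕ.m<n⇒m<1+n x₀<b , before , Qx₀)
... | inj₁ below-b with decide b
...   | inj₂ Qb = inj₂ (b , ℕ.n<1+n b , below-b , Qb)
...   | inj₁ Pb = inj₁ below-sb
  where
  below-sb : ∀ x → x < suc b → P x
  below-sb x x<sb with x ℕ.≟ b
  ... | yes refl = Pb
  ... | no x≢b = below-b x (ℕ.≤∧≢⇒< (ℕ.≤-pred x<sb) x≢b)

-- Lemma 3.1 for θ = ⟨k;r̄⟩ a congruence with k + 1 classes (so t reaches k)
-- and δ a congruence relating each x exactly to x and to n - x.
module Lemma3·1 (n : ℕ) (δ : Relation) (cδ : IsCongruence n δ)
                (δ-sound : ∀ {x y} → δ x y → x ≡ y ⊎ x + y ≡ n)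
                (δ-complement : ∀ {x y} → x + y ≡ n → δ x y)
                (k0 : ℕ) (rs : List ℕ) (inc : StrictlyIncreasing rs)
                (cθ : IsCongruence n (CongKR n (suc k0) rs)) (k≤tn : suc k0 ≤ n ∸ Δ rs n) where

  open ZigKR n k0 rs inc (IsCongruence.zig cθ)
  open Rigid k≤tn
  open Joins n θ δ cθ cδ

  θ⇒J : ∀ {x y} → θ x y → J x y
  θ⇒J θxy@(x≤n , y≤n , _) = inl x≤n y≤n θxy

  δ⇒J : ∀ {x y} → δ x y → J x y
  δ⇒J δxy = inr (proj₁ (IsCongruence.dom cδ δxy)) (proj₂ (IsCongruence.dom cδ δxy)) δxy

  -- The mirror image of the edge x — x + 1 is the edge n - x - 1 — n - x.
  mirror : ℕ → ℕ
  mirror x = n ∸ x ∸ 1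

  mirror≡ : ∀ x → mirror x ≡ n ∸ suc x
  mirror≡ x = trans (ℕ.∸-+-assoc n x 1) (cong (n ∸_) (ℕ.+-comm x 1))

  suc-mirror : ∀ {x} → x < n → suc (mirror x) ≡ n ∸ x
  suc-mirror {x} x<n = trans (cong suc (mirror≡ x)) (suc-∸ x<n)

  MirrorAt : ℕ → Set
  MirrorAt x = x ∈ rs ⇔ mirror x ∈ rs

  step-balance : ∀ {x p} → (x ∈ rs ⇔ p ∈ rs) → t (suc x) + t p ≡ t x + t (suc p)
  step-balance {x} {p} x∈⇔p∈ with x ∈? rs
  ... | yes x∈ = cong₂ _+_ (t-stutter x∈) (sym (t-stutter (Equivalence.to x∈⇔p∈ x∈)))
  ... | no x∉ = trans (cong (_+ t p) (t-advance x∉))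
                      (trans (sym (ℕ.+-suc (t x) (t p)))
                             (cong (_+_ (t x)) (sym (t-advance (x∉ ∘ Equivalence.from x∈⇔p∈)))))

  mirror-sum : ∀ {x₀} → (∀ y → y < x₀ → MirrorAt y) →
               ∀ {x} → x ≤ x₀ → x ≤ n → t x + t (n ∸ x) ≡ t n
  mirror-sum _ {zero} _ _ = cong (_+ t n) t-zero
  mirror-sum {x₀} mirrored {suc x} sx≤x₀ x<n = begin
    t (suc x) + t (n ∸ suc x)         ≡⟨ cong (λ m → t (suc x) + t m) (sym (mirror≡ x)) ⟩
    t (suc x) + t (mirror x)          ≡⟨ step-balance (mirrored x sx≤x₀) ⟩
    t x + t (suc (mirror x))          ≡⟨ cong (λ m → t x + t m) (suc-mirror x<n) ⟩
    t x + t (n ∸ x)                   ≡⟨ mirror-sum mirrored (ℕ.<⇒≤ sx≤x₀) (ℕ.<⇒≤ x<n) ⟩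
    t n                               ∎
    where open Relation.Binary.PropositionalEquality.≡-Reasoning

  -- A mirrored ⟨k;r̄⟩ is invariant under the reflection x ↦ n - x, since
  -- then t (n - x) = t n - t x and k ∣ t n.
  θ-reflect : Mirrored n rs → ∀ {a b} → θ a b → θ (n ∸ a) (n ∸ b)
  θ-reflect mirrored {a} {b} (a≤n , b≤n , ta≡±tb) =
    ℕ.m∸n≤m n a , ℕ.m∸n≤m n b ,
    ±-toKR (subst₂ (λ u v → u ≡± v [ k ]) (reflected a≤n) (reflected b≤n)
                   (±-reflect k∣tn (t-mono a≤n) (t-mono b≤n) (±-fromKR ta≡±tb)))
    where
    reflected : ∀ {x} → x ≤ n → t n ∸ t x ≡ t (n ∸ x)
    reflected {x} x≤n = trans (cong (_∸ t x) (sym (mirror-sum mirrored x≤n x≤n))) (ℕ.m+n∸m≡n (t x) _)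

  -- Part (1): a δ-step is either trivial or the reflection, and the
  -- reflection carries θ-steps to θ-steps, so θ and δ can be swapped.
  commute : Mirrored n rs → SameOn n (Comp n θ δ) (Comp n δ θ)
  commute mirrored x y x≤n y≤n = mk⇔ forward backward
    where
    forward : Comp n θ δ x y → Comp n δ θ x y
    forward (m , _ , θxm , δmy) with δ-sound δmy
    ... | inj₁ refl = x , x≤n , IsCongruence.refl cδ x≤n , θxm
    ... | inj₂ m+y≡n = n ∸ x , ℕ.m∸n≤m n x , δ-complement (ℕ.m+[n∸m]≡n x≤n) ,
                       subst (θ (n ∸ x)) (trans (cong (_∸ m) (sym m+y≡n)) (ℕ.m+n∸m≡n m y)) (θ-reflect mirrored θxm)
    backward : Comp n δ θ x y → Comp n θ δ x y
    backward (w , _ , δxw , θwy) with δ-sound δxw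
    ... | inj₁ refl = y , y≤n , θwy , IsCongruence.refl cδ y≤n
    ... | inj₂ x+w≡n = n ∸ y , ℕ.m∸n≤m n y ,
                       subst (λ u → θ u (n ∸ y)) (trans (cong (_∸ w) (sym x+w≡n)) (ℕ.m+n∸n≡m x w))
                             (θ-reflect mirrored θwy) ,
                       δ-complement (ℕ.m∸n+n≡m y≤n)

  anchor-0 : J 0 1 → IsTotal n J
  anchor-0 J01 = spread z≤n near
    where
    near : ∀ y → y ≤ n → Adj 0 y → J 0 y
    near zero y≤n _ = join-refl y≤n
    near (suc zero) _ _ = J01
    near (suc (suc _)) _ (_ , s≤s ())

  anchor-k : J k k0 → IsTotal n J
  anchor-k Jkk0 = spread k≤n near
    where
    J-k-sk : suc k ≤ n → J k (suc k)
    J-k-sk sk≤n with k ∈? rs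
    ... | yes k∈ = θ⇒J (k≤n , sk≤n , ±-toKR (subst (λ v → t k ≡± v [ k ]) (sym (t-stutter k∈)) ±-refl))
    ... | no k∉ = join-trans Jkk0 (join-sym (θ⇒J (θ-canonical sk≤n (ℕ.n≤1+n k0) tsk≡±k0)))
      where
      wrap : ∀ k0 → suc (suc k0) + k0 ≡ 2 * suc k0
      wrap = ℕ-solve
      tsk≡±k0 : t (suc k) ≡± k0 [ k ]
      tsk≡±k0 = subst (λ v → v ≡± k0 [ k ]) (sym (trans (t-advance k∉) (cong suc (t-initial ℕ.≤-refl))))
                      (plus (subst (2 * k ∣_) (sym (wrap k0)) ∣-refl))
    near : ∀ y → y ≤ n → Adj k y → J k y
    near y y≤n (k≤sy , y≤sk) with ℕ.<-cmp y k
    ... | tri< y<k _ _ = subst (J k) (ℕ.≤-antisym (ℕ.≤-pred k≤sy) (ℕ.≤-pred y<k)) Jkk0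
    ... | tri≈ _ refl _ = join-refl y≤n
    ... | tri> _ _ k<y = subst (J k) (sym y≡sk) (J-k-sk (subst (_≤ n) y≡sk y≤n))
      where
      y≡sk : y ≡ suc k
      y≡sk = ℕ.≤-antisym y≤sk k<y

  turn : ∀ {u v} → u ≤ n → v ≤ n → J u v → k ∣ t u → t v ≡ suc (t u) ⊎ suc (t v) ≡ t u → IsTotal n J
  turn u≤n v≤n Juv k∣tu tv≡tu±1 with ±-near-multiple k k∣tu tv≡tu±1
  ... | inj₁ (tu≡±0 , tv≡±1) =
    anchor-0 (join-trans (join-sym (θ⇒J (θ-canonical u≤n z≤n tu≡±0)))
                         (join-trans Juv (θ⇒J (θ-canonical v≤n (s≤s z≤n) tv≡±1))))
  ... | inj₂ (tu≡±k , tv≡±k0) =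
    anchor-k (join-trans (join-sym (θ⇒J (θ-canonical u≤n ℕ.≤-refl tu≡±k)))
                         (join-trans Juv (θ⇒J (θ-canonical v≤n (ℕ.n≤1+n k0) tv≡±k0))))

  -- A stutter s and an advance q on mirror-image edges (s + q + 1 = n) let
  -- J link q with q + 1 through  q δ s+1 θ s δ q+1.  If one of the heights
  -- of q and q + 1 is a multiple of k, J is total.
  gap-total : ∀ {s q} → s ∈ rs → q ∉ rs → s + suc q ≡ n → k ∣ t q ⊎ k ∣ t (suc q) → IsTotal n J
  gap-total {s} {q} s∈ q∉ s+sq≡n = finish
    where
    q+ss≡n : q + suc s ≡ n
    q+ss≡n = trans (ℕ.+-suc q s) (trans (cong suc (ℕ.+-comm q s)) (trans (sym (ℕ.+-suc s q)) s+sq≡n))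
    sq≤n : suc q ≤ n
    sq≤n = subst (suc q ≤_) s+sq≡n (ℕ.m≤n+m (suc q) s)
    ss≤n : suc s ≤ n
    ss≤n = subst (suc s ≤_) q+ss≡n (ℕ.m≤n+m (suc s) q)
    θ-stutter : θ (suc s) s
    θ-stutter = ss≤n , ℕ.<⇒≤ ss≤n , ±-toKR (subst (λ v → v ≡± t s [ k ]) (sym (t-stutter s∈)) ±-refl)
    J-edge : J q (suc q)
    J-edge = join-trans (δ⇒J (δ-complement q+ss≡n)) (join-trans (θ⇒J θ-stutter) (δ⇒J (δ-complement s+sq≡n)))
    finish : k ∣ t q ⊎ k ∣ t (suc q) → IsTotal n J
    finish (inj₁ k∣tq) = turn (ℕ.<⇒≤ sq≤n) sq≤n J-edge k∣tq (inj₁ (t-advance q∉))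
    finish (inj₂ k∣tsq) = turn sq≤n (ℕ.<⇒≤ sq≤n) (join-sym J-edge) k∣tsq (inj₂ (sym (t-advance q∉)))

  Mismatch : ℕ → Set
  Mismatch x = (x ∈ rs × mirror x ∉ rs) ⊎ (x ∉ rs × mirror x ∈ rs)

  mirror-or-mismatch : ∀ x → MirrorAt x ⊎ Mismatch x
  mirror-or-mismatch x with x ∈? rs | mirror x ∈? rs
  ... | yes x∈ | yes m∈ = inj₁ (mk⇔ (λ _ → m∈) (λ _ → x∈))
  ... | no x∉ | no m∉ = inj₁ (mk⇔ (⊥-elim ∘ x∉) (⊥-elim ∘ m∉))
  ... | yes x∈ | no m∉ = inj₂ (inj₁ (x∈ , m∉))
  ... | no x∉ | yes m∈ = inj₂ (inj₂ (x∉ , m∈))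

  -- Part (2): at the first mismatch x₀ the heights of x₀ and n - x₀ still add
  -- up to the multiple t n of k, and the stuttering one of them is a kink.
  total : ¬ Mirrored n rs → IsTotal n J
  total not-mirrored with first-failure mirror-or-mismatch n
  ... | inj₁ mirrored = ⊥-elim (not-mirrored mirrored)
  ... | inj₂ (x₀ , x₀<n , mirrored-below , mismatch) = resolve mismatch
    where
    sm≤n : suc (mirror x₀) ≤ n
    sm≤n = subst (_≤ n) (sym (suc-mirror x₀<n)) (ℕ.m∸n≤m n x₀)
    sum : t x₀ + t (suc (mirror x₀)) ≡ t n
    sum = trans (cong (λ m → t x₀ + t m) (suc-mirror x₀<n)) (mirror-sum mirrored-below ℕ.≤-refl (ℕ.<⇒≤ x₀<n))
    k∣sum : k ∣ t x₀ + t (suc (mirror x₀))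
    k∣sum = subst (k ∣_) (sym sum) k∣tn
    resolve : Mismatch x₀ → IsTotal n J
    resolve (inj₁ (x₀∈ , m∉)) =
      gap-total x₀∈ m∉ (trans (cong (_+_ x₀) (suc-mirror x₀<n)) (ℕ.m+[n∸m]≡n (ℕ.<⇒≤ x₀<n)))
                (inj₂ (∣m+n∣m⇒∣n k∣sum (stutter-divisible x₀∈ x₀<n)))
    resolve (inj₂ (x₀∉ , m∈)) =
      gap-total m∈ x₀∉ (trans (ℕ.+-suc (mirror x₀) x₀)
                              (trans (cong (_+ x₀) (suc-mirror x₀<n)) (ℕ.m∸n+n≡m (ℕ.<⇒≤ x₀<n))))
                (inj₁ (∣m+n∣m⇒∣n (subst (k ∣_) (ℕ.+-comm (t x₀) _) k∣sum)
                                  (subst (k ∣_) (sym (t-stutter m∈)) (stutter-divisible m∈ sm≤n))))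

lemma3p1 : (n : ℕ) (δ : Relation) → IsCongruence n δ → HasFrequency n δ 2 →
           (k : ℕ) (rs : List ℕ) → 1 ≤ k → StrictlyIncreasing rs → All (_< n) rs →
           IsCongruence n (CongKR n k rs) → NumClasses n (CongKR n k rs) (suc k) →
           (Mirrored n rs → SameOn n (Comp n (CongKR n k rs) δ) (Comp n δ (CongKR n k rs)))
           × (¬ Mirrored n rs → IsTotal n (Join n (CongKR n k rs) δ))
lemma3p1 n δ cδ (suc k0′ , rs′ , _ , _ , inc′ , below-n′ , _ , δ≈KR , length≡2k) (suc k0) rs _ inc _ cθ classes =
  Main.commute , Main.total
  where
  module δ-Shape = FrequencyTwo n δ cδ k0′ rs′ inc′ below-n′ δ≈KR length≡2k
  module θ-Shape = ZigKR n k0 rs inc (IsCongruence.zig cθ)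
  module Main = Lemma3·1 n δ cδ δ-Shape.δ-sound δ-Shape.δ-complement k0 rs inc cθ (θ-Shape.classes⇒k≤tn classes)
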